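{- Let $h\ge 2$ be an integer and let $k$ be a nonnegative integer with $s_k\le 2^h$ (so $f_{h,k}\in F_h$). Then (1) $s_{r(k)}\le 2^{h-1}$, i.e. $f_{h-1,r(k)}\in F_{h-1}$; and (2) $r(f_{h,k})=f_{h-1,r(k)}$.
   Context: Sequence $s_n$: let $A_1=(5)$ and for $k\ge2$ let $A_k$ be the concatenation $A_{k-1},A_{k-1},(1)$; $A$ is the limiting infinite list; $a_0=0$, $a_n$ is the $n$th entry of $A$ for $n\ge1$, and $s_n=a_0+\cdots+a_n$. For $i\ge1$ let $M_i=2^i-1$. $M$-expansion of a positive integer $n$: let $\ell=\max\{i:n\ge M_i\}$ and write $n=M_\ell+r$ with $0\le r\le M_\ell$; if $r=0$ stop with $n=M_\ell$; if $r=M_\ell$ stop with $n=2M_\ell$; otherwise continue with $r$. This gives $n=\varepsilon_1M_1+\cdots+\varepsilon_\ell M_\ell$ with $\varepsilon_i\in\{0,1,2\}$; set $\varepsilon_i=0$ for $i>\ell$ (all zero for $n=0$). The reduction of an integer $k$ with this expansion is $r(k)=\varepsilon_2M_1+\cdots+\varepsilon_\ell M_{\ell-1}$ ($r(k)=0$ if $\ell\le 1$, including $k=0$). $T^h$ is the complete binary tree of height $h$; a symmetric pebbling configuration on $T^h$ is written $f=\{f_0,\dots,f_h\}$, with $f_i$ the number of pebbles on each vertex of level $i$ (distance $i$ from the root). For nonnegative $k$ with $s_k\le 2^h$, $f_{h,k}$ is the symmetric configuration with $f_0=2^h-s_k$ and $f_i=2\varepsilon_i$ for $1\le i\le h$ ($\varepsilon_i$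 the $M$-digits of $k$), and $F_h=\{f_{h,k}: k\ge0,\ s_k\le 2^h\}$. For a symmetric configuration $f=\{f_0,\dots,f_h\}$ on $T^h$, its reduction is the symmetric configuration on $T^{h-1}$ given by $r(f)=\{f_0',f_2,f_3,\dots,f_h\}$ where \[ f_0'=f_1+\left\lfloor\frac{f_0+(f_1+f_2+\cdots+f_h)/2}{2}\right\rfloor . \] -}

module Defs where

open import Data.Nat using (ℕ; zero; suc; _+_; _*_; _∸_; _^_; _≤ᵇ_; _≡ᵇ_; _/_)
open import Data.Bool using (if_then_else_)
open import Data.List using (List; []; _∷_; _++_; map; upTo)
open import Data.Nat.ListAction using (sum)
open import Data.Vec using (Vec; []; _∷_; tabulate)
import Data.Vec as V
open import Data.Fin using (Fin; toℕ)
import Data.Fin as F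

-- The lists A_k.  Ablock k is A_{k+1}:  A_1 = (5),  A_{k+1} = A_k ++ A_k ++ (1).
Ablock : ℕ → List ℕ
Ablock zero    = 5 ∷ []
Ablock (suc k) = Ablock k ++ Ablock k ++ (1 ∷ [])

nth : List ℕ → ℕ → ℕ
nth []       _       = 0
nth (x ∷ xs) zero    = x
nth (x ∷ xs) (suc i) = nth xs i

-- a_0 = 0, a_n = n-th entry (1-based) of the limit list A.
-- A_{n+1} (= Ablock n) has length 2^{n+1}-1 ≥ n+1 and is a prefix of A.
a : ℕ → ℕ
a zero    = 0
a (suc n) = nth (Ablock n) n

s : ℕ → ℕ
s zero    = a zero
s (suc n) = s n + a (suc n)

M : ℕ → ℕ
M i = 2 ^ i ∸ 1

-- ell n = max { i : M_i ≤ n }  (searching downward from n; M_i ≥ i so the max is ≤ n)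
ellSearch : ℕ → ℕ → ℕ
ellSearch n zero    = 0
ellSearch n (suc i) = if M (suc i) ≤ᵇ n then suc i else ellSearch n i

ell : ℕ → ℕ
ell n = ellSearch n n

indicator : ℕ → ℕ → ℕ
indicator i l = if i ≡ᵇ l then 1 else 0

epsAux : ℕ → ℕ → ℕ → ℕ
epsAux zero     n       i = 0
epsAux (suc f)  zero    i = 0
epsAux (suc f) (suc m)  i =
  let n = suc m
      l = ell n
      r = n ∸ M l
  in if r ≡ᵇ 0 then indicator i l
     else if r ≡ᵇ M l then 2 * indicator i l
     else indicator i l + epsAux f r i

-- ε_i(k): the i-th M-digit of k (fuel k suffices since the remainder strictly decreases)
digit : ℕ → ℕ → ℕ
digit k i = epsAux k k i

redNum : ℕ → ℕ
redNum k = sum (map (λ j → digit k (suc (suc j)) * M (suc j)) (upTo (ell k ∸ 1)))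

-- Symmetric configurations on T^h are vectors {f_0,...,f_h} : Vec ℕ (suc h).
-- f_{h,k}: f_0 = 2^h - s_k, f_i = 2 ε_i(k).
config : (h k : ℕ) → Vec ℕ (suc h)
config h k = tabulate go
  where
  go : Fin (suc h) → ℕ
  go F.zero    = 2 ^ h ∸ s k
  go (F.suc j) = 2 * digit k (suc (toℕ j))

-- Reduction of a symmetric configuration on T^(h+1) to one on T^h:
-- f_0' = f_1 + ⌊(f_0 + (f_1+...+f_h)/2)/2⌋ = f_1 + ⌊(2 f_0 + (f_1+...+f_h))/4⌋.
reduceConfig : ∀ {h} → Vec ℕ (suc (suc h)) → Vec ℕ (suc h)
reduceConfig (f0 ∷ f1 ∷ rest) = (f1 + (2 * f0 + (f1 + V.sum rest)) / 4) ∷ rest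

module Submission where

-- Along one greedy step k = M_l + r of the M-expansion (r ≤ M_l) the digits of k are those of r plus
-- ε_l = 1, and s is additive: A_{l+1} = A_l A_l (1) gives s_{M_l + r} = s_{M_l} + s_r, with
-- s_{M_l} = 3 M_l + 2. Induction along such steps yields, for the digit sum Σε,
--   k = 2 r(k) + Σε  (as M_{i+1} = 2 M_i + 1),   s_k = 3k + 2 Σε,
-- and that the digits of r(k) are those of k shifted down by one. With e = ε_1 and E = Σ_{i≥2} ε_i
-- this means s_k = 6 r(k) + 5e + 5E and s_{r(k)} = 3 r(k) + 2E. Hence s_k ≤ 2^h forces
-- s_{r(k)} + 2e ≤ 2^{h-1}, and the new root count 2e + ⌊(2(2^h - s_k) + 2e + 2E)/4⌋ is exactly
-- 2^{h-1} - s_{r(k)}; the remaining levels of r(f_{h,k}) are the shifted digits.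

open import Data.Bool using (true; false; T; if_then_else_)
open import Data.Empty using (⊥-elim)
open import Data.Fin using (toℕ)
open import Data.List using (List; []; _∷_; _++_; length; applyUpTo)
import Data.List.Properties as List
open import Data.Nat
open import Data.Nat.DivMod using (m*n/n≡m)
open import Data.Nat.Induction using (<-rec)
open import Data.Nat.ListAction using (sum)
open import Data.Nat.Properties
open import Data.Nat.Solver using (module +-*-Solver)
open import Data.Product using (∃; ∃₂; _×_; _,_)
open import Data.Sum using (inj₁; inj₂)
open import Data.Unit using (tt)
open import Data.Vec as Vec using (tabulate)
open import Data.Vec.Properties using (tabulate-cong)
open import Relation.Binary.PropositionalEquality
open import Relation.Nullary using (yes; no)

open import Defs

open +-*-Solver
open import Algebra.Properties.CommutativeSemigroup +-commutativeSemigroup using () renaming (interchange to +-interchange)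
open ≡-Reasoning

M-suc : ∀ l → M (suc l) ≡ suc (2 * M l)
M-suc l with 2 ^ l | m^n>0 2 l
... | suc x | _ = +-suc x (x + 0)

suc-M : ∀ l → suc (M l) ≡ 2 ^ l
suc-M l = m+[n∸m]≡n (m^n>0 2 l)

M-suc-+ : ∀ l → M (suc l) ≡ suc (M l + M l)
M-suc-+ l = trans (M-suc l) (cong (λ x → suc (M l + x)) (+-identityʳ (M l)))

M-< : ∀ l → M l < M (suc l)
M-< l rewrite M-suc l = s≤s (m≤m+n (M l) _)

M-+-< : ∀ {l j} → j ≤ M l → M l + j < M (suc l)
M-+-< {l} j≤ rewrite M-suc l = s≤s (+-monoʳ-≤ (M l) (≤-trans j≤ (m≤m+n (M l) 0)))

M-mono-≤ : ∀ {a b} → a ≤ b → M a ≤ M b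
M-mono-≤ a≤b = ∸-monoˡ-≤ 1 (^-monoʳ-≤ 2 a≤b)

M-cancel-< : ∀ {a b} → M a < M b → a < b
M-cancel-< {a} {b} Ma<Mb with a <? b
... | yes a<b = a<b
... | no a≮b = ⊥-elim (<⇒≱ Ma<Mb (M-mono-≤ (≮⇒≥ a≮b)))

n≤M : ∀ l → l ≤ M l
n≤M zero = z≤n
n≤M (suc l) rewrite M-suc l = s≤s (≤-trans (n≤M l) (m≤m+n (M l) _))

M-pos : ∀ {l} → 1 ≤ l → 1 ≤ M l
M-pos {l} 1≤l = ≤-trans 1≤l (n≤M l)

M-suc-pos : ∀ l → 1 ≤ M (suc l)
M-suc-pos l = M-pos {suc l} (s≤s z≤n)

2^-<-M-suc : ∀ {l} → 1 ≤ l → 2 ^ l < M (suc l)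
2^-<-M-suc {l} 1≤l =
  subst₂ _<_ (suc-M l) (sym (M-suc l)) (s≤s (m<m+n (M l) (≤-trans (M-pos 1≤l) (m≤m+n (M l) 0))))

ellSearch-≡ : ∀ {n l} i → M l ≤ n → n < M (suc l) → l ≤ i → ellSearch n i ≡ l
ellSearch-≡ zero _ _ z≤n = refl
ellSearch-≡ {n} {l} (suc i) Ml≤n n< l≤ with M (suc i) ≤ᵇ n in found
... | true = ≤-antisym (≤-pred (M-cancel-< (≤-<-trans (≤ᵇ⇒≤ (M (suc i)) n (subst T (sym found) tt)) n<))) l≤
... | false with l ≟ suc i
...   | yes refl = ⊥-elim (subst T found (≤⇒≤ᵇ Ml≤n))
...   | no l≢ = ellSearch-≡ i Ml≤n n< (≤-pred (≤∧≢⇒< l≤ l≢))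

ell-spec : ∀ {n l} → M l ≤ n → n < M (suc l) → ell n ≡ l
ell-spec {n} {l} Ml≤n n< = ellSearch-≡ n Ml≤n n< (≤-trans (n≤M l) Ml≤n)

M-bracket : ∀ n → ∃ λ l → M l ≤ n × n < M (suc l)
M-bracket zero = 0 , z≤n , s≤s z≤n
M-bracket (suc n) with M-bracket n
... | l , Ml≤n , n< with suc n <? M (suc l)
...   | yes sn< = l , m≤n⇒m≤1+n Ml≤n , sn<
...   | no sn≮ = suc l , ≤-reflexive sn≡ , subst (_< M (suc (suc l))) sn≡ (M-< (suc l))
  where
  sn≡ : M (suc l) ≡ suc n
  sn≡ = ≤-antisym (≮⇒≥ sn≮) n<

M-ell-≤ : ∀ n → M (ell n) ≤ n
M-ell-≤ n with M-bracket n
... | l , Ml≤n , n< rewrite ell-spec {n} {l} Ml≤n n< = Ml≤n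

<-M-suc-ell : ∀ n → n < M (suc (ell n))
<-M-suc-ell n with M-bracket n
... | l , Ml≤n , n< rewrite ell-spec {n} {l} Ml≤n n< = n<

ell-≤ : ∀ {n l} → n < M (suc l) → ell n ≤ l
ell-≤ {n} n< = ≤-pred (M-cancel-< (≤-<-trans (M-ell-≤ n) n<))

ell-suc-pos : ∀ m → 1 ≤ ell (suc m)
ell-suc-pos m with ell (suc m) | <-M-suc-ell (suc m)
... | zero | s≤s ()
... | suc _ | _ = s≤s z≤n

<-M-suc⇒∸-≤ : ∀ {n l} → n < M (suc l) → n ∸ M l ≤ M l
<-M-suc⇒∸-≤ {n} {l} n< =
  m≤n+o⇒m∸n≤o n (M l) (≤-trans (≤-pred (subst (n <_) (M-suc l) n<)) (≤-reflexive (cong (M l +_) (+-identityʳ (M l)))))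

∑ : ℕ → (ℕ → ℕ) → ℕ
∑ n f = sum (applyUpTo f n)

∑-cong : ∀ n {f g : ℕ → ℕ} → (∀ j → f j ≡ g j) → ∑ n f ≡ ∑ n g
∑-cong zero _ = refl
∑-cong (suc n) f≗g = cong₂ _+_ (f≗g 0) (∑-cong n (λ j → f≗g (suc j)))

∑-+ : ∀ n (f g : ℕ → ℕ) → ∑ n (λ j → f j + g j) ≡ ∑ n f + ∑ n g
∑-+ zero f g = refl
∑-+ (suc n) f g = trans (cong (f 0 + g 0 +_) (∑-+ n (λ j → f (suc j)) (λ j → g (suc j))))
                        (+-interchange (f 0) (g 0) _ _)

∑-* : ∀ n c (f : ℕ → ℕ) → ∑ n (λ j → c * f j) ≡ c * ∑ n f
∑-* zero c f = sym (*-zeroʳ c)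
∑-* (suc n) c f = trans (cong (c * f 0 +_) (∑-* n c (λ j → f (suc j)))) (sym (*-distribˡ-+ c (f 0) _))

∑-zero : ∀ n {f : ℕ → ℕ} → (∀ j → f j ≡ 0) → ∑ n f ≡ 0
∑-zero zero _ = refl
∑-zero (suc n) f≗0 = cong₂ _+_ (f≗0 0) (∑-zero n (λ j → f≗0 (suc j)))

∑-extend : ∀ {a b} (f : ℕ → ℕ) → a ≤ b → (∀ j → a ≤ j → f j ≡ 0) → ∑ b f ≡ ∑ a f
∑-extend {b = b} f z≤n vanish = ∑-zero b (λ j → vanish j z≤n)
∑-extend f (s≤s a≤b) vanish = cong (f 0 +_) (∑-extend (λ j → f (suc j)) a≤b (λ j a≤j → vanish (suc j) (s≤s a≤j)))

∑-tail : ∀ {a b} (f : ℕ → ℕ) → (∀ j → a ≤ j → f j ≡ 0) → (∀ j → b ≤ j → f j ≡ 0) → ∑ a f ≡ ∑ b f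
∑-tail {a} {b} f vanishᵃ vanishᵇ with ≤-total a b
... | inj₁ a≤b = sym (∑-extend f a≤b vanishᵃ)
... | inj₂ b≤a = ∑-extend f b≤a vanishᵇ

∑-indicator : ∀ {n} c (w : ℕ → ℕ) → c < n → ∑ n (λ j → indicator j c * w j) ≡ w c
∑-indicator {suc n} zero w _ =
  trans (cong₂ _+_ (+-identityʳ (w 0)) (∑-zero n (λ _ → refl))) (+-identityʳ (w 0))
∑-indicator {suc n} (suc c) w (s≤s c<n) = ∑-indicator c (λ j → w (suc j)) c<n

sum-tabulate : ∀ n (f : ℕ → ℕ) → Vec.sum (tabulate {n = n} (λ j → f (toℕ j))) ≡ ∑ n f
sum-tabulate zero f = refl
sum-tabulate (suc n) f = cong (f 0 +_) (sum-tabulate n (λ j → f (suc j)))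

nth-++ˡ : ∀ (xs ys : List ℕ) j → j < length xs → nth (xs ++ ys) j ≡ nth xs j
nth-++ˡ (x ∷ xs) ys zero _ = refl
nth-++ˡ (x ∷ xs) ys (suc j) (s≤s j<) = nth-++ˡ xs ys j j<

nth-++ʳ : ∀ (xs ys : List ℕ) j → nth (xs ++ ys) (length xs + j) ≡ nth ys j
nth-++ʳ [] ys j = refl
nth-++ʳ (x ∷ xs) ys j = nth-++ʳ xs ys j

length-Ablock : ∀ L → length (Ablock L) ≡ M (suc L)
length-Ablock zero = refl
length-Ablock (suc L) = begin
  length (Ablock L ++ Ablock L ++ 1 ∷ [])                  ≡⟨ List.length-++ (Ablock L) ⟩
  length (Ablock L) + length (Ablock L ++ 1 ∷ [])          ≡⟨ cong (length (Ablock L) +_) (List.length-++ (Ablock L)) ⟩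
  length (Ablock L) + (length (Ablock L) + 1)              ≡⟨ cong (λ x → x + (x + 1)) (length-Ablock L) ⟩
  M (suc L) + (M (suc L) + 1)                              ≡⟨ trans (cong (M (suc L) +_) (+-comm (M (suc L)) 1)) (+-suc (M (suc L)) _) ⟩
  suc (M (suc L) + M (suc L))                              ≡⟨ M-suc-+ (suc L) ⟨
  M (suc (suc L))                                          ∎

nth-Ablock-suc : ∀ {L j} → j < M (suc L) → nth (Ablock (suc L)) j ≡ nth (Ablock L) j
nth-Ablock-suc {L} {j} j< = nth-++ˡ (Ablock L) _ j (subst (j <_) (sym (length-Ablock L)) j<)

nth-Ablock-≤′ : ∀ {L L′ j} → j < M (suc L) → L ≤′ L′ → nth (Ablock L′) j ≡ nth (Ablock L) j
nth-Ablock-≤′ j< ≤′-refl = refl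
nth-Ablock-≤′ j< (≤′-step {L′} L≤′) =
  trans (nth-Ablock-suc {L′} (<-≤-trans j< (M-mono-≤ (s≤s (≤′⇒≤ L≤′))))) (nth-Ablock-≤′ j< L≤′)

a-nth-Ablock : ∀ {L j} → j < M (suc L) → a (suc j) ≡ nth (Ablock L) j
a-nth-Ablock {L} {j} j< with ≤-total j L
... | inj₁ j≤L = sym (nth-Ablock-≤′ (≤-<-trans (n≤M j) (M-< j)) (≤⇒≤′ j≤L))
... | inj₂ L≤j = nth-Ablock-≤′ j< (≤⇒≤′ L≤j)

a-second-half : ∀ L {j} → j ≤ M (suc L) → a (suc (M (suc L) + j)) ≡ nth (Ablock L ++ 1 ∷ []) j
a-second-half L {j} j≤ = begin
  a (suc (M (suc L) + j))                        ≡⟨ a-nth-Ablock {suc L} (M-+-< {suc L} j≤) ⟩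
  nth (Ablock (suc L)) (M (suc L) + j)           ≡⟨ cong (λ x → nth (Ablock (suc L)) (x + j)) (length-Ablock L) ⟨
  nth (Ablock (suc L)) (length (Ablock L) + j)   ≡⟨ nth-++ʳ (Ablock L) _ j ⟩
  nth (Ablock L ++ 1 ∷ []) j                     ∎

a-second-copy : ∀ L {j} → j < M (suc L) → a (suc (M (suc L) + j)) ≡ a (suc j)
a-second-copy L {j} j< = begin
  a (suc (M (suc L) + j))    ≡⟨ a-second-half L (<⇒≤ j<) ⟩
  nth (Ablock L ++ 1 ∷ []) j ≡⟨ nth-++ˡ (Ablock L) _ j (subst (j <_) (sym (length-Ablock L)) j<) ⟩
  nth (Ablock L) j           ≡⟨ a-nth-Ablock {L} j< ⟨
  a (suc j)                  ∎

a-last : ∀ L → a (suc (M (suc L) + M (suc L))) ≡ 1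
a-last L = begin
  a (suc (M (suc L) + M (suc L)))              ≡⟨ a-second-half L ≤-refl ⟩
  nth (Ablock L ++ 1 ∷ []) (M (suc L))         ≡⟨ cong (nth (Ablock L ++ 1 ∷ [])) (trans (sym (length-Ablock L)) (sym (+-identityʳ _))) ⟩
  nth (Ablock L ++ 1 ∷ []) (length (Ablock L) + 0) ≡⟨ nth-++ʳ (Ablock L) _ 0 ⟩
  1                                            ∎

s-M-+ : ∀ L {r} → r ≤ M (suc L) → s (M (suc L) + r) ≡ s (M (suc L)) + s r
s-M-+ L {zero} _ = trans (cong s (+-identityʳ (M (suc L)))) (sym (+-identityʳ _))
s-M-+ L {suc j} j< = begin
  s (M (suc L) + suc j)                      ≡⟨ cong s (+-suc (M (suc L)) j) ⟩
  s (M (suc L) + j) + a (suc (M (suc L) + j)) ≡⟨ cong₂ _+_ (s-M-+ L (<⇒≤ j<)) (a-second-copy L j<) ⟩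
  s (M (suc L)) + s j + a (suc j)            ≡⟨ +-assoc (s (M (suc L))) (s j) (a (suc j)) ⟩
  s (M (suc L)) + s (suc j)                  ∎

s-M : ∀ L → s (M (suc L)) ≡ 3 * M (suc L) + 2
s-M zero = refl
s-M (suc L) = begin
  s (M (suc (suc L)))                                             ≡⟨ cong s (M-suc-+ (suc L)) ⟩
  s (M (suc L) + M (suc L)) + a (suc (M (suc L) + M (suc L)))     ≡⟨ cong₂ _+_ (s-M-+ L ≤-refl) (a-last L) ⟩
  s (M (suc L)) + s (M (suc L)) + 1                               ≡⟨ cong (λ x → x + x + 1) (s-M L) ⟩
  (3 * M (suc L) + 2) + (3 * M (suc L) + 2) + 1                   ≡⟨ solve 1 (λ x → (con 3 :* x :+ con 2) :+ (con 3 :* x :+ con 2) :+ con 1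
                                                                                   := con 3 :* (con 1 :+ (x :+ x)) :+ con 2) refl (M (suc L)) ⟩
  3 * suc (M (suc L) + M (suc L)) + 2                             ≡⟨ cong (λ x → 3 * x + 2) (M-suc-+ (suc L)) ⟨
  3 * M (suc (suc L)) + 2                                         ∎

indicator-≢ : ∀ {i l} → i ≢ l → indicator i l ≡ 0
indicator-≢ {i} {l} i≢l with i ≡ᵇ l in i≟l
... | true = ⊥-elim (i≢l (≡ᵇ⇒≡ i l (subst T (sym i≟l) tt)))
... | false = refl

suc-∸-M-ell-≤ : ∀ m → suc m ∸ M (ell (suc m)) ≤ m
suc-∸-M-ell-≤ m with M (ell (suc m)) | M-pos (ell-suc-pos m)
... | suc x | _ = m∸n≤m m x

epsAux-fuel : ∀ f f′ n i → n ≤ f → n ≤ f′ → epsAux f n i ≡ epsAux f′ n i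
epsAux-fuel zero zero zero i _ _ = refl
epsAux-fuel zero (suc f′) zero i _ _ = refl
epsAux-fuel (suc f) zero zero i _ _ = refl
epsAux-fuel (suc f) (suc f′) zero i _ _ = refl
epsAux-fuel (suc f) (suc f′) (suc m) i (s≤s m≤f) (s≤s m≤f′) =
  cong (λ x → if r ≡ᵇ 0 then indicator i l else if r ≡ᵇ M l then 2 * indicator i l else indicator i l + x)
       (epsAux-fuel f f′ r i (≤-trans (suc-∸-M-ell-≤ m) m≤f) (≤-trans (suc-∸-M-ell-≤ m) m≤f′))
  where
  l = ell (suc m)
  r = suc m ∸ M l

-- The middle branch of epsAux (remainder = M l) agrees with the last one as soon as
-- the remainder's own expansion is the single digit ε_l = 1.
epsAux-branches : ∀ m i l r → r ≤ m → (r ≢ 0 → r ≡ M l → digit r i ≡ indicator i l) →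
  (if r ≡ᵇ 0 then indicator i l else if r ≡ᵇ M l then 2 * indicator i l else indicator i l + epsAux m r i)
    ≡ indicator i l + digit r i
epsAux-branches m i l r r≤m r≡M⇒ with r ≡ᵇ 0 in r≟0
... | true rewrite ≡ᵇ⇒≡ r 0 (subst T (sym r≟0) tt) = sym (+-identityʳ (indicator i l))
... | false with r ≡ᵇ M l in r≟M
...   | true = cong (indicator i l +_) (trans (+-identityʳ (indicator i l)) (sym (r≡M⇒ r≢0 r≡M)))
  where
  r≢0 : r ≢ 0
  r≢0 r≡0 = subst T (trans (sym (cong (_≡ᵇ 0) r≡0)) r≟0) tt
  r≡M : r ≡ M l
  r≡M = ≡ᵇ⇒≡ r (M l) (subst T (sym r≟M) tt)
...   | false = cong (indicator i l +_) (epsAux-fuel m r r i r≤m ≤-refl)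

digit-suc : ∀ m i → (suc m ∸ M (ell (suc m)) ≢ 0 → suc m ∸ M (ell (suc m)) ≡ M (ell (suc m)) →
    digit (suc m ∸ M (ell (suc m))) i ≡ indicator i (ell (suc m))) →
  digit (suc m) i ≡ indicator i (ell (suc m)) + digit (suc m ∸ M (ell (suc m))) i
digit-suc m i = epsAux-branches m i (ell (suc m)) (suc m ∸ M (ell (suc m))) (suc-∸-M-ell-≤ m)

digit-M : ∀ {l} i → 1 ≤ l → digit (M l) i ≡ indicator i l
digit-M {l} i 1≤l with M l in M≡ | M-pos 1≤l
... | suc x | _ = begin
  digit (suc x) i                                           ≡⟨ digit-suc x i (λ r≢0 _ → ⊥-elim (r≢0 rest≡0)) ⟩
  indicator i (ell (suc x)) + digit (suc x ∸ M (ell (suc x))) i ≡⟨ cong₂ (λ l r → indicator i l + digit r i) ell≡ rest≡0 ⟩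
  indicator i l + 0                                         ≡⟨ +-identityʳ (indicator i l) ⟩
  indicator i l                                             ∎
  where
  ell≡ : ell (suc x) ≡ l
  ell≡ = ell-spec (≤-reflexive M≡) (subst (_< M (suc l)) M≡ (M-< l))
  rest≡0 : suc x ∸ M (ell (suc x)) ≡ 0
  rest≡0 = trans (cong (λ l → suc x ∸ M l) ell≡) (trans (cong (suc x ∸_) M≡) (n∸n≡0 (suc x)))

digit-step : ∀ {n} i → 1 ≤ n → digit n i ≡ indicator i (ell n) + digit (n ∸ M (ell n)) i
digit-step {suc m} i _ = digit-suc m i (λ _ r≡M → trans (cong (λ r → digit r i) r≡M) (digit-M i (ell-suc-pos m)))

record Split (n L r : ℕ) : Set where
  field
    ell-≡ : ell n ≡ suc L
    split-≡ : n ≡ M (suc L) + r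
    rest-≤ : r ≤ M (suc L)
    digit-≡ : ∀ i → digit n i ≡ indicator i (suc L) + digit r i

  rest-< : r < n
  rest-< = subst (r <_) (sym split-≡) (m<n+m r (M-suc-pos L))

  ell-rest-≤ : ell r ≤ suc L
  ell-rest-≤ = ell-≤ (≤-<-trans rest-≤ (M-< (suc L)))
open Split

split-of : ∀ {L r} → r ≤ M (suc L) → Split (M (suc L) + r) L r
split-of {L} {r} r≤ = record { ell-≡ = ell≡ ; split-≡ = refl ; rest-≤ = r≤ ; digit-≡ = digits }
  where
  n = M (suc L) + r
  ell≡ : ell n ≡ suc L
  ell≡ = ell-spec {l = suc L} (m≤m+n (M (suc L)) r) (M-+-< {suc L} r≤)
  digits : ∀ i → digit n i ≡ indicator i (suc L) + digit r i
  digits i = begin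
    digit n i                                     ≡⟨ digit-step i (≤-trans (M-suc-pos L) (m≤m+n (M (suc L)) r)) ⟩
    indicator i (ell n) + digit (n ∸ M (ell n)) i ≡⟨ cong (λ l → indicator i l + digit (n ∸ M l) i) ell≡ ⟩
    indicator i (suc L) + digit (n ∸ M (suc L)) i ≡⟨ cong (λ x → indicator i (suc L) + digit x i) (m+n∸m≡n (M (suc L)) r) ⟩
    indicator i (suc L) + digit r i               ∎

split-suc : ∀ m → ∃₂ λ L r → Split (suc m) L r
split-suc m with ell (suc m) in ell≡ | ell-suc-pos m
... | suc L | _ = L , r , subst (λ n → Split n L r) (m+[n∸m]≡n M≤) (split-of r≤)
  where
  r = suc m ∸ M (suc L)
  M≤ : M (suc L) ≤ suc m
  M≤ = subst (λ l → M l ≤ suc m) ell≡ (M-ell-≤ (suc m))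
  r≤ : r ≤ M (suc L)
  r≤ = <-M-suc⇒∸-≤ {l = suc L} (subst (λ l → suc m < M (suc l)) ell≡ (<-M-suc-ell (suc m)))

split-induction : (P : ℕ → Set) → P 0 → (∀ {n L r} → Split n L r → P r → P n) → ∀ n → P n
split-induction P base step = <-rec P go
  where
  go : ∀ n → (∀ {k} → k < n → P k) → P n
  go zero _ = base
  go (suc m) rec with split-suc m
  ... | _ , _ , sp = step sp (rec (rest-< sp))

digit-above-ell : ∀ n {i} → ell n < i → digit n i ≡ 0
digit-above-ell = split-induction (λ n → ∀ {i} → ell n < i → digit n i ≡ 0) (λ _ → refl) step
  where
  step : ∀ {n L r} → Split n L r → (∀ {i} → ell r < i → digit r i ≡ 0) → ∀ {i} → ell n < i → digit n i ≡ 0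
  step {n} {L} {r} sp IH {i} ell< = begin
    digit n i                       ≡⟨ digit-≡ sp i ⟩
    indicator i (suc L) + digit r i ≡⟨ cong₂ _+_ (indicator-≢ (λ i≡ → <⇒≢ sL<i (sym i≡))) (IH (≤-<-trans (ell-rest-≤ sp) sL<i)) ⟩
    0                               ∎
    where
    sL<i : suc L < i
    sL<i = subst (_< i) (ell-≡ sp) ell<

weighted : (ℕ → ℕ) → ℕ → ℕ
weighted w n = ∑ (ell n) (λ j → digit n (suc j) * w j)

weighted-tail : ∀ (w : ℕ → ℕ) n j → ell n ≤ j → digit n (suc j) * w j ≡ 0
weighted-tail w n j ell≤j = cong (_* w j) (digit-above-ell n (s≤s ell≤j))

weighted-split : ∀ {n L r} → Split n L r → ∀ w → weighted w n ≡ w L + weighted w r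
weighted-split {n} {L} {r} sp w = begin
  weighted w n
    ≡⟨ cong (λ l → ∑ l (λ j → digit n (suc j) * w j)) (ell-≡ sp) ⟩
  ∑ (suc L) (λ j → digit n (suc j) * w j)
    ≡⟨ ∑-cong (suc L) (λ j → trans (cong (_* w j) (digit-≡ sp (suc j))) (*-distribʳ-+ (w j) (indicator j L) _)) ⟩
  ∑ (suc L) (λ j → indicator j L * w j + digit r (suc j) * w j)
    ≡⟨ ∑-+ (suc L) (λ j → indicator j L * w j) (λ j → digit r (suc j) * w j) ⟩
  ∑ (suc L) (λ j → indicator j L * w j) + ∑ (suc L) (λ j → digit r (suc j) * w j)
    ≡⟨ cong₂ _+_ (∑-indicator L w ≤-refl) (∑-extend (λ j → digit r (suc j) * w j) (ell-rest-≤ sp) (weighted-tail w r)) ⟩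
  w L + weighted w r
    ∎

digitSum : ℕ → ℕ
digitSum n = ∑ (ell n) (λ j → digit n (suc j))

digitSum-split : ∀ {n L r} → Split n L r → digitSum n ≡ suc (digitSum r)
digitSum-split {n} {L} {r} sp = begin
  digitSum n                ≡⟨ ∑-cong (ell n) (λ j → sym (*-identityʳ _)) ⟩
  weighted (λ _ → 1) n      ≡⟨ weighted-split sp (λ _ → 1) ⟩
  suc (weighted (λ _ → 1) r) ≡⟨ cong suc (∑-cong (ell r) (λ j → *-identityʳ _)) ⟩
  suc (digitSum r)          ∎

-- r(k) = Σ ε_{i+1} M_i may start at i = 0 since M_0 = 0.
redNum-weighted : ∀ n → redNum n ≡ weighted M n
redNum-weighted n = trans (cong sum (List.map-upTo f (ell n ∸ 1))) (shift (ell n))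
  where
  f : ℕ → ℕ
  f j = digit n (suc (suc j)) * M (suc j)
  shift : ∀ N → ∑ (N ∸ 1) f ≡ ∑ N (λ j → digit n (suc j) * M j)
  shift zero = refl
  shift (suc N) = sym (cong (_+ ∑ N f) (*-zeroʳ (digit n 1)))

redNum-split : ∀ {n L r} → Split n L r → redNum n ≡ M L + redNum r
redNum-split {n} {L} {r} sp =
  trans (redNum-weighted n) (trans (weighted-split sp M) (cong (M L +_) (sym (redNum-weighted r))))

twice-redNum+digitSum : ∀ n → 2 * redNum n + digitSum n ≡ n
twice-redNum+digitSum = split-induction (λ n → 2 * redNum n + digitSum n ≡ n) refl step
  where
  step : ∀ {n L r} → Split n L r → 2 * redNum r + digitSum r ≡ r → 2 * redNum n + digitSum n ≡ n
  step {n} {L} {r} sp IH = begin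
    2 * redNum n + digitSum n               ≡⟨ cong₂ (λ x y → 2 * x + y) (redNum-split sp) (digitSum-split sp) ⟩
    2 * (M L + redNum r) + suc (digitSum r) ≡⟨ solve 3 (λ m x y → con 2 :* (m :+ x) :+ (con 1 :+ y) := (con 1 :+ con 2 :* m) :+ (con 2 :* x :+ y))
                                                       refl (M L) (redNum r) (digitSum r) ⟩
    suc (2 * M L) + (2 * redNum r + digitSum r) ≡⟨ cong₂ _+_ (sym (M-suc L)) IH ⟩
    M (suc L) + r                           ≡⟨ split-≡ sp ⟨
    n                                       ∎

s-digitSum : ∀ n → s n ≡ 3 * n + 2 * digitSum n
s-digitSum = split-induction (λ n → s n ≡ 3 * n + 2 * digitSum n) refl step
  where
  step : ∀ {n L r} → Split n L r → s r ≡ 3 * r + 2 * digitSum r → s n ≡ 3 * n + 2 * digitSum n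
  step {n} {L} {r} sp IH = begin
    s n                                              ≡⟨ cong s (split-≡ sp) ⟩
    s (M (suc L) + r)                                ≡⟨ s-M-+ L (rest-≤ sp) ⟩
    s (M (suc L)) + s r                              ≡⟨ cong₂ _+_ (s-M L) IH ⟩
    3 * M (suc L) + 2 + (3 * r + 2 * digitSum r)     ≡⟨ solve 3 (λ m x y → con 3 :* m :+ con 2 :+ (con 3 :* x :+ con 2 :* y)
                                                                    := con 3 :* (m :+ x) :+ con 2 :* (con 1 :+ y)) refl (M (suc L)) r (digitSum r) ⟩
    3 * (M (suc L) + r) + 2 * suc (digitSum r)       ≡⟨ cong₂ (λ x y → 3 * x + 2 * y) (split-≡ sp) (digitSum-split sp) ⟨
    3 * n + 2 * digitSum n                           ∎

n≤s : ∀ n → n ≤ s n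
n≤s n = subst (n ≤_) (sym (s-digitSum n)) (≤-trans (m≤m+n n _) (m≤m+n (3 * n) _))

half-≤ : ∀ {R x} → 2 * R ≤ suc (2 * x) → R ≤ x
half-≤ {R} {x} 2R≤ = ≤-pred (*-cancelˡ-< 2 R (suc x) (subst (2 * R <_) (sym (*-suc 2 x)) (s≤s 2R≤)))

redNum-rest-≤ : ∀ {n L r} → Split n L r → redNum r ≤ M L
redNum-rest-≤ {n} {L} {r} sp = half-≤ (≤-trans (m≤m+n (2 * redNum r) (digitSum r))
  (subst₂ _≤_ (sym (twice-redNum+digitSum r)) (M-suc L) (rest-≤ sp)))

digit-redNum : ∀ n i → digit (redNum n) (suc i) ≡ digit n (suc (suc i))
digit-redNum = split-induction (λ n → ∀ i → digit (redNum n) (suc i) ≡ digit n (suc (suc i))) (λ _ → refl) step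
  where
  step : ∀ {n L r} → Split n L r → (∀ i → digit (redNum r) (suc i) ≡ digit r (suc (suc i))) →
         ∀ i → digit (redNum n) (suc i) ≡ digit n (suc (suc i))
  step {n} {zero} {r} sp IH i = begin
    digit (redNum n) (suc i) ≡⟨ cong (λ x → digit x (suc i)) (trans (redNum-split sp) (n≤0⇒n≡0 (redNum-rest-≤ sp))) ⟩
    0                        ≡⟨ digit-above-ell r (≤-<-trans (ell-rest-≤ sp) (s≤s (s≤s z≤n))) ⟨
    digit r (suc (suc i))    ≡⟨ digit-≡ sp (suc (suc i)) ⟨
    digit n (suc (suc i))    ∎
  step {n} {suc L} {r} sp IH i = begin
    digit (redNum n) (suc i)                                     ≡⟨ cong (λ x → digit x (suc i)) (redNum-split sp) ⟩
    digit (M (suc L) + redNum r) (suc i)                         ≡⟨ digit-≡ (split-of (redNum-rest-≤ sp)) (suc i) ⟩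
    indicator (suc i) (suc L) + digit (redNum r) (suc i)         ≡⟨ cong (indicator i L +_) (IH i) ⟩
    indicator (suc (suc i)) (suc (suc L)) + digit r (suc (suc i)) ≡⟨ digit-≡ sp (suc (suc i)) ⟨
    digit n (suc (suc i))                                        ∎

ell-≤-from-s : ∀ {k l} → 1 ≤ l → s k ≤ 2 ^ l → ell k ≤ l
ell-≤-from-s {k} {l} 1≤l sk≤ = ell-≤ {l = l} (≤-<-trans (≤-trans (n≤s k) sk≤) (2^-<-M-suc 1≤l))

digitSum-upTo : ∀ {n N} → ell n ≤ N → digitSum n ≡ ∑ N (λ j → digit n (suc j))
digitSum-upTo {n} ell≤ = sym (∑-extend (λ j → digit n (suc j)) ell≤ (λ j ell≤j → digit-above-ell n (s≤s ell≤j)))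

digitSum-redNum : ∀ {k g} → ell k ≤ suc g → digitSum (redNum k) ≡ ∑ g (λ j → digit k (suc (suc j)))
digitSum-redNum {k} {g} ell≤ = trans
  (∑-tail (λ j → digit (redNum k) (suc j)) (λ j ell≤j → digit-above-ell (redNum k) (s≤s ell≤j))
          (λ j g≤j → trans (digit-redNum k j) (digit-above-ell k (s≤s (≤-trans ell≤ (s≤s g≤j))))))
  (∑-cong g (digit-redNum k))

sk-regroup : ∀ r e E → 3 * (2 * r + (e + E)) + 2 * (e + E) ≡ 2 * (3 * r + 2 * E + 2 * e) + (e + E)
sk-regroup = solve 3 (λ r e E → con 3 :* (con 2 :* r :+ (e :+ E)) :+ con 2 :* (e :+ E)
                              := con 2 :* (con 3 :* r :+ con 2 :* E :+ con 2 :* e) :+ (e :+ E)) refl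

reduced-s-bound : ∀ {X} r e E → 3 * (2 * r + (e + E)) + 2 * (e + E) ≤ 2 * X → 3 * r + 2 * E + 2 * e ≤ X
reduced-s-bound {X} r e E sk≤ =
  *-cancelˡ-≤ 2 (≤-trans (m≤m+n _ (e + E)) (subst (_≤ 2 * X) (sk-regroup r e E) sk≤))

-- Writing X = c + 2e + W, the numerator 2(2X - s_k) + 2e + 2E is exactly 4W.
reduced-root : ∀ {X} r e E → 3 * (2 * r + (e + E)) + 2 * (e + E) ≤ 2 * X →
  2 * e + (2 * (2 * X ∸ (3 * (2 * r + (e + E)) + 2 * (e + E))) + (2 * e + 2 * E)) / 4 ≡ X ∸ (3 * r + 2 * E)
reduced-root {X} r e E sk≤ with m≤n⇒∃[o]m+o≡n (reduced-s-bound {X} r e E sk≤)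
... | W , refl = begin
  2 * e + (2 * (2 * (c + 2 * e + W) ∸ sk) + (2 * e + 2 * E)) / 4 ≡⟨ cong (λ d → 2 * e + (2 * d + (2 * e + 2 * E)) / 4) difference ⟩
  2 * e + (2 * (2 * W ∸ t) + (2 * e + 2 * E)) / 4               ≡⟨ cong (λ y → 2 * e + y / 4) numerator ⟩
  2 * e + W * 4 / 4                                             ≡⟨ cong (2 * e +_) (m*n/n≡m W 4) ⟩
  2 * e + W                                                     ≡⟨ m+n∸m≡n c (2 * e + W) ⟨
  c + (2 * e + W) ∸ c                                           ≡⟨ cong (_∸ c) (+-assoc c (2 * e) W) ⟨
  c + 2 * e + W ∸ c                                             ∎
  where
  c = 3 * r + 2 * E
  t = e + E
  sk = 3 * (2 * r + t) + 2 * t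
  base = 2 * (c + 2 * e)
  t≤2W : t ≤ 2 * W
  t≤2W = +-cancelˡ-≤ base t (2 * W) (subst₂ _≤_ (sk-regroup r e E) (*-distribˡ-+ 2 (c + 2 * e) W) sk≤)
  difference : 2 * (c + 2 * e + W) ∸ sk ≡ 2 * W ∸ t
  difference = trans (cong₂ _∸_ (*-distribˡ-+ 2 (c + 2 * e) W) (sk-regroup r e E)) ([m+n]∸[m+o]≡n∸o base (2 * W) t)
  numerator : 2 * (2 * W ∸ t) + (2 * e + 2 * E) ≡ W * 4
  numerator = begin
    2 * (2 * W ∸ t) + (2 * e + 2 * E) ≡⟨ cong (2 * (2 * W ∸ t) +_) (*-distribˡ-+ 2 e E) ⟨
    2 * (2 * W ∸ t) + 2 * t           ≡⟨ *-distribˡ-+ 2 (2 * W ∸ t) t ⟨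
    2 * (2 * W ∸ t + t)               ≡⟨ cong (2 *_) (m∸n+n≡m t≤2W) ⟩
    2 * (2 * W)                       ≡⟨ solve 1 (λ W → con 2 :* (con 2 :* W) := W :* con 4) refl W ⟩
    W * 4                             ∎

lemma3p3 : (g k : ℕ) → let h = suc g in
    2 ≤ h → s k ≤ 2 ^ h →
    (s (redNum k) ≤ 2 ^ (h ∸ 1)) × (reduceConfig (config h k) ≡ config (h ∸ 1) (redNum k))
lemma3p3 g k _ sk≤ = subst (_≤ 2 ^ g) (sym sr≡) (≤-trans (m≤m+n _ (2 * e)) (reduced-s-bound r e E sk≤′)) ,
                      cong₂ Vec._∷_ root (tabulate-cong (λ j → cong (2 *_) (sym (digit-redNum k (toℕ j)))))
  where
  r = redNum k
  e = digit k 1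
  E = ∑ g (λ j → digit k (suc (suc j)))
  ell-k≤ : ell k ≤ suc g
  ell-k≤ = ell-≤-from-s {k} (s≤s z≤n) sk≤
  sk≡ : s k ≡ 3 * (2 * r + (e + E)) + 2 * (e + E)
  sk≡ = trans (s-digitSum k) (cong₂ (λ x y → 3 * x + 2 * y)
          (trans (sym (twice-redNum+digitSum k)) (cong (2 * r +_) (digitSum-upTo {k} ell-k≤))) (digitSum-upTo {k} ell-k≤))
  sr≡ : s r ≡ 3 * r + 2 * E
  sr≡ = trans (s-digitSum r) (cong (λ y → 3 * r + 2 * y) (digitSum-redNum {k} ell-k≤))
  sk≤′ : 3 * (2 * r + (e + E)) + 2 * (e + E) ≤ 2 * 2 ^ g
  sk≤′ = subst (_≤ 2 ^ suc g) sk≡ sk≤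
  root : 2 * e + (2 * (2 ^ suc g ∸ s k) + (2 * e + Vec.sum (tabulate {n = g} (λ j → 2 * digit k (suc (suc (toℕ j))))))) / 4
         ≡ 2 ^ g ∸ s r
  root = begin
    2 * e + (2 * (2 ^ suc g ∸ s k) + (2 * e + Vec.sum (tabulate {n = g} (λ j → 2 * digit k (suc (suc (toℕ j))))))) / 4
      ≡⟨ cong₂ (λ x v → 2 * e + (2 * (2 ^ suc g ∸ x) + (2 * e + v)) / 4) sk≡
               (trans (sum-tabulate g (λ j → 2 * digit k (suc (suc j)))) (∑-* g 2 _)) ⟩
    2 * e + (2 * (2 * 2 ^ g ∸ (3 * (2 * r + (e + E)) + 2 * (e + E))) + (2 * e + 2 * E)) / 4
      ≡⟨ reduced-root r e E sk≤′ ⟩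
    2 ^ g ∸ (3 * r + 2 * E)
      ≡⟨ cong (2 ^ g ∸_) sr≡ ⟨
    2 ^ g ∸ s r
      ∎
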